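{- Let $L$ be a first-order language. (i) For every $L$-structure $\mathbb A$ and every $a\in\mathbb A$, we have $(\mathbb A,\mathbb A)\models a\approx a$ (reflexivity in a single structure). (ii) For every $L$-structure $\mathbb A$ and all $a,b\in\mathbb A$, if $(\mathbb A,\mathbb A)\models a\approx b$ then $(\mathbb A,\mathbb A)\models b\approx a$ (symmetry in a single structure). (iii) Similarity in a single structure is in general not transitive: there exist a first-order language $L$, an $L$-structure $\mathbb A$ and elements $a,b,c\in\mathbb A$ such that $(\mathbb A,\mathbb A)\models a\approx b$ and $(\mathbb A,\mathbb A)\models b\approx c$ but not $(\mathbb A,\mathbb A)\models a\approx c$. (iv) In a pair of structures reflexivity may fail: there exist a first-order language $L$, $L$-structures $\mathbb A,\mathbb B$ and an element $a$ belonging to the universes of both $\mathbb A$ and $\mathbb B$ such that $(\mathbb A,\mathbb B)\not\models a\approx a$.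
   Context: Fix a first-order language $L$. Universes of different $L$-structures are arbitrary sets and may share elements. An $L$-formula is called conjunctive if it contains no disjunctions and negation occurs only directly in front of atomic formulas. For an $L$-structure $\mathbb A$ and $a\in\mathbb A$, the conjunctive type of $a$ is $c\text-Type_\mathbb A(a):=\{\varphi(y)\mid \varphi \text{ a conjunctive } L\text{ -formula with one free variable } y,\ \mathbb A\models\varphi(a)\}$. For $L$-structures $\mathbb A,\mathbb B$ and $a\in\mathbb A$, $b\in\mathbb B$, put $T(a,b):=c\text-Type_\mathbb A(a)\cap c\text-Type_\mathbb B(b)$. Define $(\mathbb A,\mathbb B)\models a\lesssim b$ iff $T(a,b)$ is $\subseteq$-maximal with respect to $b$ except for $a$ in case $a\in\mathbb B$, i.e. there is no $b'\in\mathbb B$ with $b'\neq a$ such that $T(a,b)\subsetneq T(a,b')$. Define $(\mathbb A,\mathbb B)\models a\approx b$ iff $(\mathbb A,\mathbb B)\models a\lesssim b$ and $(\mathbb B,\mathbb A)\models b\lesssim a$; in this case $a$ and $b$ are called similar in $(\mathbb A,\mathbb B)$. -}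

module Defs where

open import Level using (0ℓ)
open import Data.Nat using (ℕ; suc)
open import Data.Fin using (Fin; zero; suc)
open import Data.Vec using (Vec; []; _∷_)
open import Data.Vec.Relation.Unary.All using (All)
open import Data.Product using (Σ; _×_)
open import Relation.Binary.PropositionalEquality using (_≡_; _≢_)
open import Relation.Nullary using (¬_)
open import Relation.Unary using (Pred; _⊂_)

record Language : Set₁ where
  field
    FunSym   : Set
    funArity : FunSym → ℕ
    RelSym   : Set
    relArity : RelSym → ℕ
open Language public

module _ (L : Language) where

  data Term (n : ℕ) : Set where
    var : Fin n → Term n
    app : (f : FunSym L) → Vec (Term n) (funArity L f) → Term n

  -- Conjunctive formulas with free variables among Fin n:
  -- atomic formulas, negated atomic formulas, ∧, ∃, ∀ (no ∨,
  -- negation only in front of atomic formulas).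
  data CForm (n : ℕ) : Set where
    eq   : Term n → Term n → CForm n
    neq  : Term n → Term n → CForm n
    rel  : (R : RelSym L) → Vec (Term n) (relArity L R) → CForm n
    nrel : (R : RelSym L) → Vec (Term n) (relArity L R) → CForm n
    _∧_  : CForm n → CForm n → CForm n
    ex   : CForm (suc n) → CForm n
    all  : CForm (suc n) → CForm n

-- An L-structure whose universe is a subset of an ambient type U of
-- elements, so that universes of different structures may share elements.
record Structure (L : Language) (U : Set) : Set₁ where
  field
    dom       : U → Set
    funI      : (f : FunSym L) → Vec U (funArity L f) → U
    funClosed : (f : FunSym L) (xs : Vec U (funArity L f)) →
                All dom xs → dom (funI f xs)
    relI      : (R : RelSym L) → Vec U (relArity L R) → Set
open Structure public

extend : {U : Set} {n : ℕ} → U → (Fin n → U) → Fin (suc n) → U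
extend x ρ zero    = x
extend x ρ (suc i) = ρ i

module _ {L : Language} {U : Set} (A : Structure L U) where

  mutual
    eval : {n : ℕ} → (Fin n → U) → Term L n → U
    eval ρ (var i)    = ρ i
    eval ρ (app f ts) = funI A f (evalVec ρ ts)

    evalVec : {n k : ℕ} → (Fin n → U) → Vec (Term L n) k → Vec U k
    evalVec ρ []       = []
    evalVec ρ (t ∷ ts) = eval ρ t ∷ evalVec ρ ts

  Sat : {n : ℕ} → CForm L n → (Fin n → U) → Set
  Sat (eq s t)    ρ = eval ρ s ≡ eval ρ t
  Sat (neq s t)   ρ = ¬ (eval ρ s ≡ eval ρ t)
  Sat (rel R ts)  ρ = relI A R (evalVec ρ ts)
  Sat (nrel R ts) ρ = ¬ relI A R (evalVec ρ ts)
  Sat (φ ∧ ψ)     ρ = Sat φ ρ × Sat ψ ρ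
  Sat (ex φ)      ρ = Σ U (λ x → dom A x × Sat φ (extend x ρ))
  Sat (all φ)     ρ = (x : U) → dom A x → Sat φ (extend x ρ)

  cType : U → Pred (CForm L 1) 0ℓ
  cType a φ = Sat φ (λ _ → a)

module _ {L : Language} {U : Set} where

  T : Structure L U → Structure L U → U → U → Pred (CForm L 1) 0ℓ
  T A B a b φ = cType A a φ × cType B b φ

  Lesssim : Structure L U → Structure L U → U → U → Set
  Lesssim A B a b =
    ¬ Σ U (λ b' → dom B b' × b' ≢ a × (T A B a b ⊂ T A B a b'))

  Approx : Structure L U → Structure L U → U → U → Set
  Approx A B a b = Lesssim A B a b × Lesssim B A b a

-- Parts (i) and (ii) are immediate from the definitions: T(a,b') ⊆ c-Type(a) = T(a,a)
-- inside one structure, and ≈ is symmetric by construction.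
--
-- Both counterexamples rest on one preservation principle: if h maps A₁ × A₂ onto B,
-- preserves atomic and negated atomic formulas in the product sense, and identifies two
-- pairs only when they agree in some coordinate, then every conjunctive formula true of
-- x in A₁ and of y in A₂ is true of h x y in B.
--
-- (iii) Take points a, b, c with two colours, red = {a, b} and blue = {b, c}, and close
-- the universe under a pairing map so that the structure maps onto itself from its own
-- square. Then a ≈ b and b ≈ c, because red (resp. blue) pins down the partner. But the
-- pair ⟨a, c⟩ ≠ a inherits T(a, c) and in addition is not blue, so a ≲ c fails.
--
-- (iv) On the booleans, let A colour true and B colour false. Negation is an isomorphism
-- A ≅ B, so T(true, true) ⊆ c-Type_A(true) = c-Type_B(false) = T(true, false), and the
-- colour formula makes the inclusion strict.
module Submission where

open import Defs
open import Data.Bool using (Bool; true; false; not)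
open import Data.Bool.Properties using (not-involutive; not-injective)
open import Data.Empty using (⊥)
open import Data.Fin using (Fin; zero; suc)
open import Data.Product using (Σ; _×_; _,_; proj₂)
open import Data.Sum using (_⊎_; inj₁; inj₂; swap)
open import Data.Unit using (⊤; tt)
open import Data.Vec using (Vec; []; _∷_; zipWith)
open import Function using (id)
open import Relation.Binary.PropositionalEquality
  using (_≡_; _≢_; _≗_; refl; sym; trans; cong; cong₂; subst; module ≡-Reasoning)
open import Relation.Nullary using (¬_)
open import Relation.Unary using (_⊆_)

module _ {L : Language} {U : Set} where

  Approx-refl : (A : Structure L U) (a : U) → Approx A A a a
  Approx-refl A a = no-improvement , no-improvement
    where
    no-improvement : Lesssim A A a a
    no-improvement (_ , _ , _ , _ , T⊈) = T⊈ (λ (ta , _) → ta , ta)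

  Approx-sym : {A B : Structure L U} {a b : U} → Approx A B a b → Approx B A b a
  Approx-sym (a≲b , b≲a) = b≲a , a≲b

  isolating⇒Lesssim : {A B : Structure L U} {a b : U} (φ : CForm L 1) → T A B a b φ →
                      (∀ {b'} → dom B b' → cType B b' φ → b' ≡ a ⊎ b' ≡ b) →
                      Lesssim A B a b
  isolating⇒Lesssim φ φ∈T isolates (b' , b'∈B , b'≢a , T⊆ , T⊈)
    with isolates b'∈B (proj₂ (T⊆ {φ} φ∈T))
  ... | inj₁ b'≡a = b'≢a b'≡a
  ... | inj₂ refl = T⊈ id

  witness⇒¬Lesssim : {A B : Structure L U} {a b : U} (b' : U) → dom B b' → b' ≢ a →
                     T A B a b ⊆ T A B a b' →
                     (φ : CForm L 1) → T A B a b' φ → ¬ cType B b φ →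
                     ¬ Lesssim A B a b
  witness⇒¬Lesssim b' b'∈B b'≢a T⊆ φ φ∈T φ∉b a≲b =
    a≲b (b' , b'∈B , b'≢a , (λ {ψ} → T⊆ {ψ}) , λ T⊇ → φ∉b (proj₂ (T⊇ {φ} φ∈T)))

  record ProductHom (A₁ A₂ B : Structure L U) : Set where
    field
      map      : U → U → U
      map-dom  : ∀ {x y} → dom A₁ x → dom A₂ y → dom B (map x y)
      map-onto : ∀ {z} → dom B z →
                 Σ U λ x → Σ U λ y → dom A₁ x × dom A₂ y × map x y ≡ z
      map-fun  : ∀ f xs ys →
                 map (funI A₁ f xs) (funI A₂ f ys) ≡ funI B f (zipWith map xs ys)
      map-rel  : ∀ R xs ys → relI A₁ R xs → relI A₂ R ys → relI B R (zipWith map xs ys)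
      map-nrel : ∀ R xs ys → ¬ relI A₁ R xs → ¬ relI A₂ R ys →
                 ¬ relI B R (zipWith map xs ys)
      map-≢    : ∀ {x₁ x₂ y₁ y₂} → map x₁ x₂ ≡ map y₁ y₂ → x₁ ≢ y₁ → x₂ ≢ y₂ → ⊥

  module _ {A₁ A₂ B : Structure L U} (h : ProductHom A₁ A₂ B) where
    open ProductHom h

    Lies-over : ∀ {n} → (Fin n → U) → (Fin n → U) → (Fin n → U) → Set
    Lies-over ρ ρ₁ ρ₂ = ρ ≗ λ k → map (ρ₁ k) (ρ₂ k)

    extend-lies-over : ∀ {n} {ρ ρ₁ ρ₂ : Fin n → U} {x x₁ x₂} → x ≡ map x₁ x₂ →
                       Lies-over ρ ρ₁ ρ₂ →
                       Lies-over (extend x ρ) (extend x₁ ρ₁) (extend x₂ ρ₂)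
    extend-lies-over x≡ _  zero    = x≡
    extend-lies-over _  ρ≗ (suc k) = ρ≗ k

    mutual
      eval-map : ∀ {n} {ρ ρ₁ ρ₂ : Fin n → U} → Lies-over ρ ρ₁ ρ₂ → (t : Term L n) →
                 eval B ρ t ≡ map (eval A₁ ρ₁ t) (eval A₂ ρ₂ t)
      eval-map ρ≗ (var k)    = ρ≗ k
      eval-map {ρ = ρ} {ρ₁} {ρ₂} ρ≗ (app f ts) = begin
        funI B f (evalVec B ρ ts)
          ≡⟨ cong (funI B f) (evalVec-map ρ≗ ts) ⟩
        funI B f (zipWith map (evalVec A₁ ρ₁ ts) (evalVec A₂ ρ₂ ts))
          ≡⟨ sym (map-fun f _ _) ⟩
        map (funI A₁ f (evalVec A₁ ρ₁ ts)) (funI A₂ f (evalVec A₂ ρ₂ ts))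
          ∎
        where open ≡-Reasoning

      evalVec-map : ∀ {n k} {ρ ρ₁ ρ₂ : Fin n → U} → Lies-over ρ ρ₁ ρ₂ →
                    (ts : Vec (Term L n) k) →
                    evalVec B ρ ts ≡ zipWith map (evalVec A₁ ρ₁ ts) (evalVec A₂ ρ₂ ts)
      evalVec-map ρ≗ []       = refl
      evalVec-map ρ≗ (t ∷ ts) = cong₂ _∷_ (eval-map ρ≗ t) (evalVec-map ρ≗ ts)

    Sat-map : ∀ {n} (φ : CForm L n) {ρ ρ₁ ρ₂ : Fin n → U} → Lies-over ρ ρ₁ ρ₂ →
              Sat A₁ φ ρ₁ → Sat A₂ φ ρ₂ → Sat B φ ρ
    Sat-map (eq s t) ρ≗ s≡t₁ s≡t₂ =
      trans (eval-map ρ≗ s) (trans (cong₂ map s≡t₁ s≡t₂) (sym (eval-map ρ≗ t)))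
    Sat-map (neq s t) ρ≗ s≢t₁ s≢t₂ s≡t =
      map-≢ (trans (sym (eval-map ρ≗ s)) (trans s≡t (eval-map ρ≗ t))) s≢t₁ s≢t₂
    Sat-map (rel R ts) ρ≗ r₁ r₂ =
      subst (relI B R) (sym (evalVec-map ρ≗ ts)) (map-rel R _ _ r₁ r₂)
    Sat-map (nrel R ts) ρ≗ ¬r₁ ¬r₂ r =
      map-nrel R _ _ ¬r₁ ¬r₂ (subst (relI B R) (evalVec-map ρ≗ ts) r)
    Sat-map (φ ∧ ψ) ρ≗ (φ₁ , ψ₁) (φ₂ , ψ₂) = Sat-map φ ρ≗ φ₁ φ₂ , Sat-map ψ ρ≗ ψ₁ ψ₂
    Sat-map (ex φ) ρ≗ (x₁ , x₁∈A₁ , φ₁) (x₂ , x₂∈A₂ , φ₂) =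
      map x₁ x₂ , map-dom x₁∈A₁ x₂∈A₂ , Sat-map φ (extend-lies-over refl ρ≗) φ₁ φ₂
    Sat-map (all φ) ρ≗ φ₁ φ₂ x x∈B with map-onto x∈B
    ... | x₁ , x₂ , x₁∈A₁ , x₂∈A₂ , refl =
      Sat-map φ (extend-lies-over refl ρ≗) (φ₁ x₁ x₁∈A₁) (φ₂ x₂ x₂∈A₂)

    cType-map : ∀ {x y} (φ : CForm L 1) → cType A₁ x φ → cType A₂ y φ →
                cType B (map x y) φ
    cType-map φ = Sat-map φ (λ _ → refl)

unaryLanguage : Set → Language
unaryLanguage S = record { FunSym = ⊥ ; funArity = λ () ; RelSym = S ; relArity = λ _ → 1 }

unaryStructure : {S U : Set} → (U → Set) → (S → U → Set) → Structure (unaryLanguage S) U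
unaryStructure D P = record
  { dom = D ; funI = λ () ; funClosed = λ () ; relI = λ { R (x ∷ []) → P R x } }

data Point : Set where
  a b c : Point
  ⟨_,_⟩ : Point → Point → Point

data Colour : Set where
  red blue : Colour

Coloured : Colour → Point → Set
Coloured _    ⟨ _ , _ ⟩ = ⊥
Coloured red  a = ⊤
Coloured red  b = ⊤
Coloured red  c = ⊥
Coloured blue a = ⊥
Coloured blue b = ⊤
Coloured blue c = ⊤

Leaf : Point → Set
Leaf ⟨ _ , _ ⟩ = ⊥
Leaf _         = ⊤

-- A pair of letters is identified with its first coordinate whenever that respects the
-- colours, which is always except for {a, c}; this makes the pairing onto.
pair : Point → Point → Point
pair a         a         = a
pair a         b         = a
pair a         c         = ⟨ a , c ⟩
pair b         a         = b
pair b         b         = b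
pair b         c         = b
pair c         a         = ⟨ c , a ⟩
pair c         b         = c
pair c         c         = c
pair a         ⟨ y , z ⟩ = ⟨ a , ⟨ y , z ⟩ ⟩
pair b         ⟨ y , z ⟩ = ⟨ b , ⟨ y , z ⟩ ⟩
pair c         ⟨ y , z ⟩ = ⟨ c , ⟨ y , z ⟩ ⟩
pair ⟨ x , y ⟩ z         = ⟨ ⟨ x , y ⟩ , z ⟩

pair-cases : ∀ x y → (pair x y ≡ x × Leaf x) ⊎ pair x y ≡ ⟨ x , y ⟩
pair-cases a         a         = inj₁ (refl , tt)
pair-cases a         b         = inj₁ (refl , tt)
pair-cases a         c         = inj₂ refl
pair-cases b         a         = inj₁ (refl , tt)
pair-cases b         b         = inj₁ (refl , tt)
pair-cases b         c         = inj₁ (refl , tt)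
pair-cases c         a         = inj₂ refl
pair-cases c         b         = inj₁ (refl , tt)
pair-cases c         c         = inj₁ (refl , tt)
pair-cases a         ⟨ _ , _ ⟩ = inj₂ refl
pair-cases b         ⟨ _ , _ ⟩ = inj₂ refl
pair-cases c         ⟨ _ , _ ⟩ = inj₂ refl
pair-cases ⟨ _ , _ ⟩ _         = inj₂ refl

leaf≢pair : ∀ {x y z} → Leaf x → x ≢ ⟨ y , z ⟩
leaf≢pair leaf refl = leaf

pair-≢ : ∀ {x₁ x₂ y₁ y₂} → pair x₁ x₂ ≡ pair y₁ y₂ → x₁ ≢ y₁ → x₂ ≢ y₂ → ⊥
pair-≢ {x₁} {x₂} {y₁} {y₂} p≡q x₁≢y₁ _ with pair-cases x₁ x₂ | pair-cases y₁ y₂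
... | inj₁ (p≡x , _)    | inj₁ (q≡y , _)    = x₁≢y₁ (trans (sym p≡x) (trans p≡q q≡y))
... | inj₁ (p≡x , leaf) | inj₂ q≡⟨y⟩        = leaf≢pair leaf (trans (sym p≡x) (trans p≡q q≡⟨y⟩))
... | inj₂ p≡⟨x⟩        | inj₁ (q≡y , leaf) = leaf≢pair leaf (trans (sym q≡y) (trans (sym p≡q) p≡⟨x⟩))
... | inj₂ p≡⟨x⟩        | inj₂ q≡⟨y⟩        = x₁≢y₁ (first (trans (sym p≡⟨x⟩) (trans p≡q q≡⟨y⟩)))
  where
  first : ∀ {x y u v} → ⟨ x , y ⟩ ≡ ⟨ u , v ⟩ → x ≡ u
  first refl = refl

pair-colour : ∀ R x y → Coloured R x → Coloured R y → Coloured R (pair x y)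
pair-colour red  a a _ _ = tt
pair-colour red  a b _ _ = tt
pair-colour red  b a _ _ = tt
pair-colour red  b b _ _ = tt
pair-colour blue b b _ _ = tt
pair-colour blue b c _ _ = tt
pair-colour blue c b _ _ = tt
pair-colour blue c c _ _ = tt

pair-¬colour : ∀ R x y → ¬ Coloured R x → ¬ Coloured R y → ¬ Coloured R (pair x y)
pair-¬colour R x y ¬Rx _ with pair-cases x y
... | inj₁ (p≡x , _) = λ Rp → ¬Rx (subst (Coloured R) p≡x Rp)
... | inj₂ p≡⟨x,y⟩   = λ Rp → subst (Coloured R) p≡⟨x,y⟩ Rp

InA : Point → Set
InA ⟨ x , y ⟩ = InA x × InA y × pair x y ≡ ⟨ x , y ⟩
InA _         = ⊤

𝔸 : Structure (unaryLanguage Colour) Point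
𝔸 = unaryStructure InA Coloured

pair-InA : ∀ {x y} → InA x → InA y → InA (pair x y)
pair-InA {x} {y} x∈A y∈A with pair-cases x y
... | inj₁ (p≡x , _) = subst InA (sym p≡x) x∈A
... | inj₂ p≡⟨x,y⟩   = subst InA (sym p≡⟨x,y⟩) (x∈A , y∈A , p≡⟨x,y⟩)

pair-onto : ∀ {z} → InA z → Σ Point λ x → Σ Point λ y → InA x × InA y × pair x y ≡ z
pair-onto {a}         _                  = a , a , tt , tt , refl
pair-onto {b}         _                  = b , b , tt , tt , refl
pair-onto {c}         _                  = c , c , tt , tt , refl
pair-onto {⟨ x , y ⟩} (x∈A , y∈A , p≡z) = x , y , x∈A , y∈A , p≡z

pairing : ProductHom 𝔸 𝔸 𝔸
pairing = record
  { map      = pair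
  ; map-dom  = pair-InA
  ; map-onto = pair-onto
  ; map-fun  = λ ()
  ; map-rel  = λ { R (x ∷ []) (y ∷ []) → pair-colour R x y }
  ; map-nrel = λ { R (x ∷ []) (y ∷ []) → pair-¬colour R x y }
  ; map-≢    = pair-≢
  }

red-cases : ∀ {x} → Coloured red x → x ≡ a ⊎ x ≡ b
red-cases {a} _ = inj₁ refl
red-cases {b} _ = inj₂ refl

blue-cases : ∀ {x} → Coloured blue x → x ≡ b ⊎ x ≡ c
blue-cases {b} _ = inj₁ refl
blue-cases {c} _ = inj₂ refl

isRed isBlue : CForm (unaryLanguage Colour) 1
isRed  = rel red  (var zero ∷ [])
isBlue = rel blue (var zero ∷ [])

a≈b : Approx 𝔸 𝔸 a b
a≈b = isolating⇒Lesssim isRed (tt , tt) (λ _ → red-cases)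
    , isolating⇒Lesssim isRed (tt , tt) (λ _ r → swap (red-cases r))

b≈c : Approx 𝔸 𝔸 b c
b≈c = isolating⇒Lesssim isBlue (tt , tt) (λ _ → blue-cases)
    , isolating⇒Lesssim isBlue (tt , tt) (λ _ r → swap (blue-cases r))

a≉c : ¬ Approx 𝔸 𝔸 a c
a≉c (a≲c , _) =
  witness⇒¬Lesssim ⟨ a , c ⟩ (tt , tt , refl) (λ ())
    (λ {φ} (φa , φc) → φa , cType-map pairing φ φa φc)
    (nrel blue (var zero ∷ [])) ((λ ()) , (λ ())) (λ ¬blue → ¬blue tt) a≲c

𝔹₁ 𝔹₂ : Structure (unaryLanguage ⊤) Bool
𝔹₁ = unaryStructure (λ _ → ⊤) (λ _ x → x ≡ true)
𝔹₂ = unaryStructure (λ _ → ⊤) (λ _ x → x ≡ false)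

negation : ProductHom 𝔹₁ 𝔹₁ 𝔹₂
negation = record
  { map      = λ x _ → not x
  ; map-dom  = λ _ _ → tt
  ; map-onto = λ {z} _ → not z , not z , tt , tt , not-involutive z
  ; map-fun  = λ ()
  ; map-rel  = λ { _ (true ∷ []) (_ ∷ []) refl _ → refl }
  ; map-nrel = λ { _ (true ∷ []) (_ ∷ []) ¬true _ _ → ¬true refl
               ; _ (false ∷ []) (_ ∷ []) _ _ () }
  ; map-≢    = λ p≡q x₁≢y₁ _ → x₁≢y₁ (not-injective p≡q)
  }

true≉true : ¬ Approx 𝔹₁ 𝔹₂ true true
true≉true (true≲true , _) =
  witness⇒¬Lesssim false tt (λ ())
    (λ {φ} (φ₁ , _) → φ₁ , cType-map negation φ φ₁ φ₁)
    (rel tt (var zero ∷ [])) (refl , refl) (λ ()) true≲true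

theorem1 :
    ((L : Language) (U : Set) (A : Structure L U) (a : U) →
      dom A a → Approx A A a a)
    ×
    ((L : Language) (U : Set) (A : Structure L U) (a b : U) →
      dom A a → dom A b → Approx A A a b → Approx A A b a)
    ×
    Σ Language (λ L → Σ Set (λ U → Σ (Structure L U) (λ A →
      Σ U (λ a → Σ U (λ b → Σ U (λ c →
        dom A a × dom A b × dom A c ×
        Approx A A a b × Approx A A b c × ¬ Approx A A a c))))))
    ×
    Σ Language (λ L → Σ Set (λ U → Σ (Structure L U) (λ A →
      Σ (Structure L U) (λ B → Σ U (λ a →
        dom A a × dom B a × ¬ Approx A B a a)))))
theorem1 =
    (λ _ _ A a _ → Approx-refl A a)
  , (λ _ _ _ _ _ _ _ → Approx-sym)
  , (unaryLanguage Colour , Point , 𝔸 , a , b , c , tt , tt , tt , a≈b , b≈c , a≉c)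
  , (unaryLanguage ⊤ , Bool , 𝔹₁ , 𝔹₂ , true , tt , tt , true≉true)
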